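{- In PCMLL, let $R$ be a $\otimes_e$ rule (resp. a $\odot_e$ rule) with conclusion $\Gamma[\Delta]\vdash C$ whose premises are the conclusion $\Delta\vdash A\otimes B$ (resp. $\Delta\vdash A\odot B$) of a proof $\delta_0$ and a sequent $\Gamma[(A,B)]\vdash C$ (resp. $\Gamma[\langle A;B\rangle]\vdash C$) concluded by a rule $R'$ applied to a proof $\delta_1$ of a sequent $\Theta[(A,B)]\vdash X$ (resp. $\Theta[\langle A;B\rangle]\vdash X$) containing both hypothesis occurrences $A,B$ (and, if $R'$ is binary, to a second proof $\delta_2$ of $\Psi\vdash U$). Then one obtains a proof of the same sequent $\Gamma[\Delta]\vdash C$ by first applying $\otimes_e$ (resp. $\odot_e$) to $\delta_0$ and $\delta_1$, producing $\Theta[\Delta]\vdash X$, and then applying $R'$ to this proof (and possibly to $\delta_2$).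
   Context: PCMLL (de Groote's partially commutative intuitionistic multiplicative linear logic) in natural deduction, sequent style. Formulas are built from propositional variables with $\otimes$, $\odot$, $\multimap$, $\backslash$, $/$. Contexts are finite multisets of formula occurrences with a series–parallel partial order, written with $(\Gamma,\Delta)$ (disjoint union, no order between parts) and $\langle\Gamma;\Delta\rangle$ (all of $\Gamma$ before all of $\Delta$), identified up to equality as partially ordered multisets; $\Gamma[\;]$ is a context with a hole and $\Gamma[\Delta]$ the result of filling it. Rules: axiom $A\vdash A$; $\backslash_e$: $\Gamma\vdash A$, $\Delta\vdash A\backslash C$ give $\langle\Gamma;\Delta\rangle\vdash C$; $/_e$: $\Delta\vdash C/A$, $\Gamma\vdash A$ give $\langle\Delta;\Gamma\rangle\vdash C$; $\multimap_e$: $\Gamma\vdash A$, $\Delta\vdash A\multimap C$ give $(\Gamma,\Delta)\vdash C$; $\backslash_i$: $\langle A;\Gamma\rangle\vdash C$ gives $\Gamma\vdash A\backslash C$; $/_i$: $\langle\Gamma;A\rangle\vdash C$ gives $\Gamma\vdash C/A$; $\multimap_i$: $(A,\Gamma)\vdash C$ gives $\Gamma\vdash A\multimap C$; $\odot_i$: $\Delta\vdash A$, $\Gamma\vdash B$ give $\langle\Delta;\Gamma\rangle\vdash A\odot B$; $\otimes_i$: same giving $(\Delta,\Gamma)\vdash A\otimes B$; $\odot_e$: $\Delta\vdash A\odot B$ and $\Gamma[\langle A;B\rangle]\vdash C$ give $\Gamma[\Delta]\vdash C$; $\otimes_e$: $\Delta\vdash A\otimes B$ and $\Gamma[(A,B)]\vdash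 C$ give $\Gamma[\Delta]\vdash C$ (the occurrences $A,B$ being equivalent in the order: any other element is below $A$ iff below $B$ and above $A$ iff above $B$; $A<B$ for $\odot_e$, incomparable for $\otimes_e$); entropy: $\Gamma\vdash C$ gives $\Gamma'\vdash C$ whenever $\Gamma'$ has the same multiset as $\Gamma$ and every order relation of $\Gamma'$ holds in $\Gamma$. -}

module Defs where

open import Data.Nat using (ℕ)
open import Data.Maybe using (Maybe; just; nothing)
open import Function using (id)
open import Function.Bundles using (_↔_; Inverse)
open import Relation.Binary.PropositionalEquality using (_≡_)

infixr 30 _⊗_ _⊙_
infixr 25 _⊸_ _⧵_
infixl 25 _⧸_

data Form : Set where
  var : ℕ → Form
  _⊗_ : Form → Form → Form   -- commutative product
  _⊙_ : Form → Form → Form   -- non-commutative product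
  _⊸_ : Form → Form → Form
  _⧵_ : Form → Form → Form
  _⧸_ : Form → Form → Form

-- Series–parallel contexts (terms), with leaves labelled in L.
-- (Γ ,, Δ) is the parallel composition (Γ,Δ); ⟨ Γ ⨾ Δ ⟩ is the series
-- composition ⟨Γ;Δ⟩.  ∅ is the empty context.

data Ctx (L : Set) : Set where
  ∅     : Ctx L
  [_]   : L → Ctx L
  _,,_  : Ctx L → Ctx L → Ctx L
  ⟨_⨾_⟩ : Ctx L → Ctx L → Ctx L

mapCtx : {L M : Set} → (L → M) → Ctx L → Ctx M
mapCtx f ∅ = ∅
mapCtx f [ a ] = [ f a ]
mapCtx f (Γ ,, Δ) = mapCtx f Γ ,, mapCtx f Δ
mapCtx f ⟨ Γ ⨾ Δ ⟩ = ⟨ mapCtx f Γ ⨾ mapCtx f Δ ⟩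

-- Formula occurrences (positions of leaves) of a context.
data Pos {L : Set} : Ctx L → Set where
  here : {a : L} → Pos [ a ]
  parL : {Γ Δ : Ctx L} → Pos Γ → Pos (Γ ,, Δ)
  parR : {Γ Δ : Ctx L} → Pos Δ → Pos (Γ ,, Δ)
  serL : {Γ Δ : Ctx L} → Pos Γ → Pos ⟨ Γ ⨾ Δ ⟩
  serR : {Γ Δ : Ctx L} → Pos Δ → Pos ⟨ Γ ⨾ Δ ⟩

label : {L : Set} {Γ : Ctx L} → Pos Γ → L
label (here {a = a}) = a
label (parL p) = label p
label (parR p) = label p
label (serL p) = label p
label (serR p) = label p

data Before {L : Set} : {Γ : Ctx L} → Pos Γ → Pos Γ → Set where
  ser   : {Γ Δ : Ctx L} {p : Pos Γ} {q : Pos Δ} → Before {Γ = ⟨ Γ ⨾ Δ ⟩} (serL p) (serR q)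
  inSerL : {Γ Δ : Ctx L} {p q : Pos Γ} → Before p q → Before {Γ = ⟨ Γ ⨾ Δ ⟩} (serL p) (serL q)
  inSerR : {Γ Δ : Ctx L} {p q : Pos Δ} → Before p q → Before {Γ = ⟨ Γ ⨾ Δ ⟩} (serR p) (serR q)
  inParL : {Γ Δ : Ctx L} {p q : Pos Γ} → Before p q → Before {Γ = Γ ,, Δ} (parL p) (parL q)
  inParR : {Γ Δ : Ctx L} {p q : Pos Δ} → Before p q → Before {Γ = Γ ,, Δ} (parR p) (parR q)

-- Entropy relation Γ' ⊑ Γ : same multiset (a label-preserving bijection
-- of occurrences) and every order relation of Γ' holds in Γ.
-- (Equality of partially ordered multisets is a special case.)
record _⊑_ {L : Set} (Γ' Γ : Ctx L) : Set where
  field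
    σ        : Pos Γ' ↔ Pos Γ
    labelsOk : (p : Pos Γ') → label (Inverse.to σ p) ≡ label p
    orderOk  : {p q : Pos Γ'} → Before p q → Before (Inverse.to σ p) (Inverse.to σ q)

data Hole (L : Set) : Set where
  □    : Hole L
  _,,ₗ_ : Hole L → Ctx L → Hole L
  _,,ᵣ_ : Ctx L → Hole L → Hole L
  ⟨_⨾ₗ_⟩ : Hole L → Ctx L → Hole L
  ⟨_⨾ᵣ_⟩ : Ctx L → Hole L → Hole L

plug : {L : Set} → Hole L → Ctx L → Ctx L
plug □ P = P
plug (H ,,ₗ Δ) P = plug H P ,, Δ
plug (Δ ,,ᵣ H) P = Δ ,, plug H P
plug ⟨ H ⨾ₗ Δ ⟩ P = ⟨ plug H P ⨾ Δ ⟩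
plug ⟨ Δ ⨾ᵣ H ⟩ P = ⟨ Δ ⨾ plug H P ⟩

mapHole : {L M : Set} → (L → M) → Hole L → Hole M
mapHole f □ = □
mapHole f (H ,,ₗ Δ) = mapHole f H ,,ₗ mapCtx f Δ
mapHole f (Δ ,,ᵣ H) = mapCtx f Δ ,,ᵣ mapHole f H
mapHole f ⟨ H ⨾ₗ Δ ⟩ = ⟨ mapHole f H ⨾ₗ mapCtx f Δ ⟩
mapHole f ⟨ Δ ⨾ᵣ H ⟩ = ⟨ mapCtx f Δ ⨾ᵣ mapHole f H ⟩

-- Γ ● : the hole context Γ[ ] seen as a context over Maybe Form, the hole
-- being a single inert marker leaf ● = nothing.  It is used to describe
-- a rule instance whose premise Θ[P] and conclusion Γ[P] share the very
-- same occurrences P (tracked through the rule).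
_● : Hole Form → Ctx (Maybe Form)
H ● = plug (mapHole just H) [ nothing ]

data Mode : Set where
  tens dot : Mode

conn : Mode → Form → Form → Form
conn tens A B = A ⊗ B
conn dot  A B = A ⊙ B

pair : {L : Set} → Mode → Ctx L → Ctx L → Ctx L
pair tens Γ Δ = Γ ,, Δ
pair dot  Γ Δ = ⟨ Γ ⨾ Δ ⟩

data Kind1 : Set where
  k⧵i k⧸i k⊸i kent : Kind1

data Kind2 : Set where
  k⧵e k⧸e k⊸e : Kind2
  kprodi kprode : Mode → Kind2

module Rules {L : Set} (ι : Form → L) where

  -- unary rules:  Rule1 Γ₁ X Γ C  is an instance with premise Γ₁ ⊢ X
  -- and conclusion Γ ⊢ C
  data Rule1 : Ctx L → Form → Ctx L → Form → Set where
    ⧵i  : {A C : Form} {Γ : Ctx L} → Rule1 ⟨ [ ι A ] ⨾ Γ ⟩ C Γ (A ⧵ C)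
    ⧸i  : {A C : Form} {Γ : Ctx L} → Rule1 ⟨ Γ ⨾ [ ι A ] ⟩ C Γ (C ⧸ A)
    ⊸i  : {A C : Form} {Γ : Ctx L} → Rule1 ([ ι A ] ,, Γ) C Γ (A ⊸ C)
    ent : {C : Form} {Γ Γ' : Ctx L} → Γ' ⊑ Γ → Rule1 Γ C Γ' C

  -- binary rules:  Rule2 Γ₁ X₁ Γ₂ X₂ Γ C  has left premise Γ₁ ⊢ X₁,
  -- right premise Γ₂ ⊢ X₂, and conclusion Γ ⊢ C
  data Rule2 : Ctx L → Form → Ctx L → Form → Ctx L → Form → Set where
    ⧵e : {A C : Form} {Γ Δ : Ctx L} → Rule2 Γ A Δ (A ⧵ C) ⟨ Γ ⨾ Δ ⟩ C
    ⧸e : {A C : Form} {Γ Δ : Ctx L} → Rule2 Δ (C ⧸ A) Γ A ⟨ Δ ⨾ Γ ⟩ C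
    ⊸e : {A C : Form} {Γ Δ : Ctx L} → Rule2 Γ A Δ (A ⊸ C) (Γ ,, Δ) C
    prodi : (m : Mode) {A B : Form} {Γ Δ : Ctx L} →
            Rule2 Δ A Γ B (pair m Δ Γ) (conn m A B)
    -- ⊗_e (m = tens) and ⊙_e (m = dot); the hole expresses that A,B
    -- are equivalent occurrences
    prode : (m : Mode) (H : Hole L) {A B C : Form} {Δ : Ctx L} →
            Rule2 Δ (conn m A B) (plug H (pair m [ ι A ] [ ι B ])) C (plug H Δ) C

  kind1 : {Γ₁ Γ : Ctx L} {X C : Form} → Rule1 Γ₁ X Γ C → Kind1
  kind1 ⧵i = k⧵i
  kind1 ⧸i = k⧸i
  kind1 ⊸i = k⊸i
  kind1 (ent _) = kent

  kind2 : {Γ₁ Γ₂ Γ : Ctx L} {X₁ X₂ C : Form} → Rule2 Γ₁ X₁ Γ₂ X₂ Γ C → Kind2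
  kind2 ⧵e = k⧵e
  kind2 ⧸e = k⧸e
  kind2 ⊸e = k⊸e
  kind2 (prodi m) = kprodi m
  kind2 (prode m H) = kprode m

open Rules {Form} id public

module ●R = Rules {Maybe Form} just

infix 5 _⊢_

data _⊢_ : Ctx Form → Form → Set where
  ax : {A : Form} → [ A ] ⊢ A
  r1 : {Γ₁ Γ : Ctx Form} {X C : Form} →
       Rule1 Γ₁ X Γ C → Γ₁ ⊢ X → Γ ⊢ C
  r2 : {Γ₁ Γ₂ Γ : Ctx Form} {X₁ X₂ C : Form} →
       Rule2 Γ₁ X₁ Γ₂ X₂ Γ C → Γ₁ ⊢ X₁ → Γ₂ ⊢ X₂ → Γ ⊢ C

-- Filling the hole marker ● with Δ is an instance of substituting contexts
-- for leaves.  Substitution commutes with plugging and preserves the entropy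
-- order: the occurrences of a substituted context are the pairs (occurrence,
-- occurrence inside what was substituted there), ordered lexicographically,
-- so a label-preserving, order-preserving bijection of the outer occurrences
-- induces one of the substituted contexts.  Hence every rule instance R'
-- with premise Θ[●] and conclusion Γ[●] becomes, after filling ● with Δ, an
-- instance of the same rule from Θ[Δ] to Γ[Δ], which is applied on top of
-- the ⊗ₑ/⊙ₑ step producing Θ[Δ] ⊢ X.
module Submission where

open import Defs
open import Data.Maybe using (Maybe; just; maybe′)
open import Data.Product using (Σ; _×_; _,_; proj₂; uncurry)
import Data.Product as Product
open import Data.Product.Function.Dependent.Propositional using (Σ-↔)
open import Function using (id)
open import Function.Bundles using (_↔_; Inverse; mk↔ₛ′)
open import Function.Properties.Inverse using (↔-refl; ↔-sym; ↔-trans)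
open import Relation.Binary.PropositionalEquality using (_≡_; refl; sym; trans; cong; cong₂)

module _ {L M : Set} (f : L → Ctx M) where

  bind : Ctx L → Ctx M
  bind ∅ = ∅
  bind [ a ] = f a
  bind (Γ ,, Δ) = bind Γ ,, bind Δ
  bind ⟨ Γ ⨾ Δ ⟩ = ⟨ bind Γ ⨾ bind Δ ⟩

  bindHole : Hole L → Hole M
  bindHole □ = □
  bindHole (H ,,ₗ Δ) = bindHole H ,,ₗ bind Δ
  bindHole (Δ ,,ᵣ H) = bind Δ ,,ᵣ bindHole H
  bindHole ⟨ H ⨾ₗ Δ ⟩ = ⟨ bindHole H ⨾ₗ bind Δ ⟩
  bindHole ⟨ Δ ⨾ᵣ H ⟩ = ⟨ bind Δ ⨾ᵣ bindHole H ⟩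

  bind-plug : (H : Hole L) (P : Ctx L) → bind (plug H P) ≡ plug (bindHole H) (bind P)
  bind-plug □ P = refl
  bind-plug (H ,,ₗ Δ) P = cong (_,, bind Δ) (bind-plug H P)
  bind-plug (Δ ,,ᵣ H) P = cong (bind Δ ,,_) (bind-plug H P)
  bind-plug ⟨ H ⨾ₗ Δ ⟩ P = cong ⟨_⨾ bind Δ ⟩ (bind-plug H P)
  bind-plug ⟨ Δ ⨾ᵣ H ⟩ P = cong ⟨ bind Δ ⨾_⟩ (bind-plug H P)

  bind-pair : (m : Mode) (Γ Δ : Ctx L) → bind (pair m Γ Δ) ≡ pair m (bind Γ) (bind Δ)
  bind-pair tens Γ Δ = refl
  bind-pair dot Γ Δ = refl

  module _ {g : M → L} (f∘g≡[_] : ∀ a → f (g a) ≡ [ a ]) where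

    bind-mapCtx : (Γ : Ctx M) → bind (mapCtx g Γ) ≡ Γ
    bind-mapCtx ∅ = refl
    bind-mapCtx [ a ] = f∘g≡[_] a
    bind-mapCtx (Γ ,, Δ) = cong₂ _,,_ (bind-mapCtx Γ) (bind-mapCtx Δ)
    bind-mapCtx ⟨ Γ ⨾ Δ ⟩ = cong₂ ⟨_⨾_⟩ (bind-mapCtx Γ) (bind-mapCtx Δ)

    bindHole-mapHole : (H : Hole M) → bindHole (mapHole g H) ≡ H
    bindHole-mapHole □ = refl
    bindHole-mapHole (H ,,ₗ Δ) = cong₂ _,,ₗ_ (bindHole-mapHole H) (bind-mapCtx Δ)
    bindHole-mapHole (Δ ,,ᵣ H) = cong₂ _,,ᵣ_ (bind-mapCtx Δ) (bindHole-mapHole H)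
    bindHole-mapHole ⟨ H ⨾ₗ Δ ⟩ = cong₂ ⟨_⨾ₗ_⟩ (bindHole-mapHole H) (bind-mapCtx Δ)
    bindHole-mapHole ⟨ Δ ⨾ᵣ H ⟩ = cong₂ ⟨_⨾ᵣ_⟩ (bind-mapCtx Δ) (bindHole-mapHole H)

  PosBind : Ctx L → Set
  PosBind Γ = Σ (Pos Γ) (λ p → Pos (f (label p)))

  graft : {Γ : Ctx L} (p : Pos Γ) → Pos (f (label p)) → Pos (bind Γ)
  graft here q = q
  graft (parL p) q = parL (graft p q)
  graft (parR p) q = parR (graft p q)
  graft (serL p) q = serL (graft p q)
  graft (serR p) q = serR (graft p q)

  split : (Γ : Ctx L) → Pos (bind Γ) → PosBind Γ
  split [ a ] q = here , q
  split (Γ ,, Δ) (parL x) = Product.map parL id (split Γ x)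
  split (Γ ,, Δ) (parR x) = Product.map parR id (split Δ x)
  split ⟨ Γ ⨾ Δ ⟩ (serL x) = Product.map serL id (split Γ x)
  split ⟨ Γ ⨾ Δ ⟩ (serR x) = Product.map serR id (split Δ x)

  split-graft : {Γ : Ctx L} (p : Pos Γ) (q : Pos (f (label p))) → split Γ (graft p q) ≡ (p , q)
  split-graft here q = refl
  split-graft (parL p) q = cong (Product.map parL id) (split-graft p q)
  split-graft (parR p) q = cong (Product.map parR id) (split-graft p q)
  split-graft (serL p) q = cong (Product.map serL id) (split-graft p q)
  split-graft (serR p) q = cong (Product.map serR id) (split-graft p q)

  graft-split : (Γ : Ctx L) (x : Pos (bind Γ)) → uncurry graft (split Γ x) ≡ x
  graft-split [ a ] x = refl
  graft-split (Γ ,, Δ) (parL x) = cong parL (graft-split Γ x)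
  graft-split (Γ ,, Δ) (parR x) = cong parR (graft-split Δ x)
  graft-split ⟨ Γ ⨾ Δ ⟩ (serL x) = cong serL (graft-split Γ x)
  graft-split ⟨ Γ ⨾ Δ ⟩ (serR x) = cong serR (graft-split Δ x)

  PosBind↔Pos : (Γ : Ctx L) → PosBind Γ ↔ Pos (bind Γ)
  PosBind↔Pos Γ = mk↔ₛ′ (uncurry graft) (split Γ) (graft-split Γ) (uncurry split-graft)

  label-graft : {Γ : Ctx L} (p : Pos Γ) (q : Pos (f (label p))) → label (graft p q) ≡ label q
  label-graft here q = refl
  label-graft (parL p) q = label-graft p q
  label-graft (parR p) q = label-graft p q
  label-graft (serL p) q = label-graft p q
  label-graft (serR p) q = label-graft p q

  label-split : (Γ : Ctx L) (x : Pos (bind Γ)) → label x ≡ label (proj₂ (split Γ x))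
  label-split [ a ] x = refl
  label-split (Γ ,, Δ) (parL x) = label-split Γ x
  label-split (Γ ,, Δ) (parR x) = label-split Δ x
  label-split ⟨ Γ ⨾ Δ ⟩ (serL x) = label-split Γ x
  label-split ⟨ Γ ⨾ Δ ⟩ (serR x) = label-split Δ x

  data Lex {Γ : Ctx L} : PosBind Γ → PosBind Γ → Set where
    outer : {p p′ : Pos Γ} {q : Pos (f (label p))} {q′ : Pos (f (label p′))} →
            Before p p′ → Lex (p , q) (p′ , q′)
    inner : {p : Pos Γ} {q q′ : Pos (f (label p))} → Before q q′ → Lex (p , q) (p , q′)

  graft-outer : {Γ : Ctx L} {p p′ : Pos Γ} (q : Pos (f (label p))) (q′ : Pos (f (label p′))) →
                Before p p′ → Before (graft p q) (graft p′ q′)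
  graft-outer q q′ ser = ser
  graft-outer q q′ (inSerL b) = inSerL (graft-outer q q′ b)
  graft-outer q q′ (inSerR b) = inSerR (graft-outer q q′ b)
  graft-outer q q′ (inParL b) = inParL (graft-outer q q′ b)
  graft-outer q q′ (inParR b) = inParR (graft-outer q q′ b)

  graft-inner : {Γ : Ctx L} (p : Pos Γ) {q q′ : Pos (f (label p))} →
                Before q q′ → Before (graft p q) (graft p q′)
  graft-inner here b = b
  graft-inner (parL p) b = inParL (graft-inner p b)
  graft-inner (parR p) b = inParR (graft-inner p b)
  graft-inner (serL p) b = inSerL (graft-inner p b)
  graft-inner (serR p) b = inSerR (graft-inner p b)

  graft-Lex : {Γ : Ctx L} {a b : PosBind Γ} → Lex a b → Before (uncurry graft a) (uncurry graft b)
  graft-Lex (outer b) = graft-outer _ _ b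
  graft-Lex (inner {p = p} b) = graft-inner p b

  module _ {Γ Δ : Ctx L} {a b : PosBind Γ} where

    Lex-parL : Lex a b → Lex {Γ ,, Δ} (Product.map parL id a) (Product.map parL id b)
    Lex-parL (outer c) = outer (inParL c)
    Lex-parL (inner c) = inner c

    Lex-serL : Lex a b → Lex {⟨ Γ ⨾ Δ ⟩} (Product.map serL id a) (Product.map serL id b)
    Lex-serL (outer c) = outer (inSerL c)
    Lex-serL (inner c) = inner c

  module _ {Γ Δ : Ctx L} {a b : PosBind Δ} where

    Lex-parR : Lex a b → Lex {Γ ,, Δ} (Product.map parR id a) (Product.map parR id b)
    Lex-parR (outer c) = outer (inParR c)
    Lex-parR (inner c) = inner c

    Lex-serR : Lex a b → Lex {⟨ Γ ⨾ Δ ⟩} (Product.map serR id a) (Product.map serR id b)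
    Lex-serR (outer c) = outer (inSerR c)
    Lex-serR (inner c) = inner c

  split-Before : (Γ : Ctx L) {x y : Pos (bind Γ)} → Before x y → Lex (split Γ x) (split Γ y)
  split-Before [ a ] b = inner b
  split-Before (Γ ,, Δ) (inParL b) = Lex-parL (split-Before Γ b)
  split-Before (Γ ,, Δ) (inParR b) = Lex-parR (split-Before Δ b)
  split-Before ⟨ Γ ⨾ Δ ⟩ ser = outer ser
  split-Before ⟨ Γ ⨾ Δ ⟩ (inSerL b) = Lex-serL (split-Before Γ b)
  split-Before ⟨ Γ ⨾ Δ ⟩ (inSerR b) = Lex-serR (split-Before Δ b)

  transportPos : {l l′ : L} → l ≡ l′ → Pos (f l) ↔ Pos (f l′)
  transportPos refl = ↔-refl

  label-transportPos : {l l′ : L} (e : l ≡ l′) (q : Pos (f l)) →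
                       label (Inverse.to (transportPos e) q) ≡ label q
  label-transportPos refl q = refl

  transportPos-Before : {l l′ : L} (e : l ≡ l′) {q q′ : Pos (f l)} → Before q q′ →
                        Before (Inverse.to (transportPos e) q) (Inverse.to (transportPos e) q′)
  transportPos-Before refl b = b

  bind-⊑ : {Γ′ Γ : Ctx L} → Γ′ ⊑ Γ → bind Γ′ ⊑ bind Γ
  bind-⊑ {Γ′} {Γ} E = record { σ = σ′ ; labelsOk = labelsOk′ ; orderOk = orderOk′ }
    where
      open _⊑_ E
      fibre : {p : Pos Γ′} → Pos (f (label p)) ↔ Pos (f (label (Inverse.to σ p)))
      fibre {p} = transportPos (sym (labelsOk p))

      σ′ : Pos (bind Γ′) ↔ Pos (bind Γ)
      σ′ = ↔-trans (↔-sym (PosBind↔Pos Γ′)) (↔-trans (Σ-↔ σ fibre) (PosBind↔Pos Γ))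

      moveFibres : PosBind Γ′ → PosBind Γ
      moveFibres (p , q) = Inverse.to σ p , Inverse.to fibre q

      label-moveFibres : (a : PosBind Γ′) → label (uncurry graft (moveFibres a)) ≡ label (proj₂ a)
      label-moveFibres (p , q) =
        trans (label-graft (Inverse.to σ p) _) (label-transportPos (sym (labelsOk p)) q)

      moveFibres-Lex : {a b : PosBind Γ′} → Lex a b → Lex (moveFibres a) (moveFibres b)
      moveFibres-Lex (outer c) = outer (orderOk c)
      moveFibres-Lex (inner {p = p} c) = inner (transportPos-Before (sym (labelsOk p)) c)

      labelsOk′ : (x : Pos (bind Γ′)) → label (Inverse.to σ′ x) ≡ label x
      labelsOk′ x = trans (label-moveFibres (split Γ′ x)) (sym (label-split Γ′ x))

      orderOk′ : {x y : Pos (bind Γ′)} → Before x y → Before (Inverse.to σ′ x) (Inverse.to σ′ y)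
      orderOk′ b = graft-Lex (moveFibres-Lex (split-Before Γ′ b))

Rule1Of : Kind1 → Ctx Form → Form → Ctx Form → Form → Set
Rule1Of k P X Q C = Σ (Rule1 P X Q C) λ R → kind1 R ≡ k

Rule2Of : Kind2 → Ctx Form → Form → Ctx Form → Form → Ctx Form → Form → Set
Rule2Of k P X Q Y R C = Σ (Rule2 P X Q Y R C) λ R′ → kind2 R′ ≡ k

castRule1Of : {k : Kind1} {X C : Form} {P P′ Q Q′ : Ctx Form} →
              P ≡ P′ → Q ≡ Q′ → Rule1Of k P X Q C → Rule1Of k P′ X Q′ C
castRule1Of refl refl R = R

castRule2Of : {k : Kind2} {X Y C : Form} {P P′ Q Q′ R R′ : Ctx Form} →
              P ≡ P′ → Q ≡ Q′ → R ≡ R′ → Rule2Of k P X Q Y R C → Rule2Of k P′ X Q′ Y R′ C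
castRule2Of refl refl refl R = R

module Fill (D : Ctx Form) where

  fill : Maybe Form → Ctx Form
  fill = maybe′ [_] D

  bind-mapCtx-just : (Ψ : Ctx Form) → bind fill (mapCtx just Ψ) ≡ Ψ
  bind-mapCtx-just = bind-mapCtx fill (λ _ → refl)

  bind-● : (H : Hole Form) → bind fill (H ●) ≡ plug H D
  bind-● H = trans (bind-plug fill (mapHole just H) [ _ ])
                   (cong (λ K → plug K D) (bindHole-mapHole fill (λ _ → refl) H))

  fill-Rule1 : {P Q : Ctx (Maybe Form)} {X C : Form} (R : ●R.Rule1 P X Q C) →
               Rule1Of (●R.kind1 R) (bind fill P) X (bind fill Q) C
  fill-Rule1 ●R.⧵i = ⧵i , refl
  fill-Rule1 ●R.⧸i = ⧸i , refl
  fill-Rule1 ●R.⊸i = ⊸i , refl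
  fill-Rule1 (●R.ent E) = ent (bind-⊑ fill E) , refl

  fill-Rule2 : {P Q R : Ctx (Maybe Form)} {X Y C : Form} (R′ : ●R.Rule2 P X Q Y R C) →
               Rule2Of (●R.kind2 R′) (bind fill P) X (bind fill Q) Y (bind fill R) C
  fill-Rule2 ●R.⧵e = ⧵e , refl
  fill-Rule2 ●R.⧸e = ⧸e , refl
  fill-Rule2 ●R.⊸e = ⊸e , refl
  fill-Rule2 (●R.prodi m {Γ = Γ} {Δ}) rewrite bind-pair fill m Δ Γ = prodi m , refl
  fill-Rule2 (●R.prode m H {A} {B} {Δ = Δ′})
    rewrite bind-plug fill H (pair m [ just A ] [ just B ])
          | bind-plug fill H Δ′
          | bind-pair fill m [ just A ] [ just B ] = prode m (bindHole fill H) , refl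

mainTheorem6 : (m : Mode) {A B C X : Form} {Δ : Ctx Form} (Θ Γ : Hole Form)
    (δ₀ : Δ ⊢ conn m A B) (δ₁ : plug Θ (pair m [ A ] [ B ]) ⊢ X) →
    ((R' : ●R.Rule1 (Θ ●) X (Γ ●) C) →
    Σ (plug Γ Δ ⊢ C) λ d → Σ (Rule1 (plug Θ Δ) X (plug Γ Δ) C) λ R'' →
    kind1 R'' ≡ ●R.kind1 R' × d ≡ r1 R'' (r2 (prode m Θ) δ₀ δ₁))
    ×
    ({Ψ : Ctx Form} {U : Form} (δ₂ : Ψ ⊢ U) →
    (R' : ●R.Rule2 (Θ ●) X (mapCtx just Ψ) U (Γ ●) C) →
    Σ (plug Γ Δ ⊢ C) λ d → Σ (Rule2 (plug Θ Δ) X Ψ U (plug Γ Δ) C) λ R'' →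
    kind2 R'' ≡ ●R.kind2 R' × d ≡ r2 R'' (r2 (prode m Θ) δ₀ δ₁) δ₂)
    ×
    ({Ψ : Ctx Form} {U : Form} (δ₂ : Ψ ⊢ U) →
    (R' : ●R.Rule2 (mapCtx just Ψ) U (Θ ●) X (Γ ●) C) →
    Σ (plug Γ Δ ⊢ C) λ d → Σ (Rule2 Ψ U (plug Θ Δ) X (plug Γ Δ) C) λ R'' →
    kind2 R'' ≡ ●R.kind2 R' × d ≡ r2 R'' δ₂ (r2 (prode m Θ) δ₀ δ₁))
mainTheorem6 m {X = X} {Δ = Δ} Θ Γ δ₀ δ₁ =
    (λ R' → let (R'' , k) = castRule1Of (bind-● Θ) (bind-● Γ) (fill-Rule1 R')
            in r1 R'' δ , R'' , k , refl)
  , (λ {Ψ} δ₂ R' → let (R'' , k) = castRule2Of (bind-● Θ) (bind-mapCtx-just Ψ) (bind-● Γ)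
                                                (fill-Rule2 R')
                   in r2 R'' δ δ₂ , R'' , k , refl)
  , (λ {Ψ} δ₂ R' → let (R'' , k) = castRule2Of (bind-mapCtx-just Ψ) (bind-● Θ) (bind-● Γ)
                                                (fill-Rule2 R')
                   in r2 R'' δ₂ δ , R'' , k , refl)
  where
    open Fill Δ
    δ : plug Θ Δ ⊢ X
    δ = r2 (prode m Θ) δ₀ δ₁
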